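{- Let $\mathscr{H}(K_3)$ be the set of all homomorphic copies of $K_3$. For every integer $k\geq 2$, $GR^{\ast}_k(K_3) = GR_{k-1}(\mathscr{H}(K_3)) = GR_{k-1}(K_3)$.
   Context: A $k$-edge-coloring is a map from the edge set to $[k]$; a subgraph is rainbow if its edges have distinct colors and monochromatic if they all have the same color. A Gallai-$k$-coloring is a $k$-edge-coloring of a complete graph with no rainbow triangle. A graph $G$ is a homomorphic copy of $H$ if there is a map $\varphi:V(H)\to V(G)$ with $\varphi(u)\varphi(v)\in E(G)$ for every $uv\in E(H)$; a monochromatic homomorphic copy of $H$ is a monochromatic subgraph that is a homomorphic copy of $H$. $GR_k(H)$ is the minimum $N$ such that every Gallai-$k$-coloring of $K_N$ contains a monochromatic copy of $H$; for a set $\mathscr{H}$ of graphs, $GR_k(\mathscr{H})$ is the minimum $N$ such that every Gallai-$k$-coloring of $K_N$ contains a monochromatic copy of some member of $\mathscr{H}$. For a set $V$, $\binom{V}{\leq 2}$ denotes the nonempty subsets of $V$ of size at most $2$. $GR^{\ast}_k(H)$ is the minimum integer $N^\ast$ such that for every coloring $c:\binom{[N^\ast]}{\leq 2}\to[k]$, either the restriction of $c$ to the $2$-subsets (viewed as an edge-coloring of $K_{N^\ast}$) contains a rainbow triangle or a monochromatic homomorphic copy of $H$, or $c(\{i,j\})=c(\{i\})$ or $c(\{i,j\})=c(\{j\})$ for some $1\leq i<j\leq N^\ast$. -}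

module Defs where

open import Data.Nat using (ℕ; _≤_)
open import Data.Fin using (Fin; _<_)
open import Data.Bool using (Bool; true)
open import Data.Product using (Σ; _×_; ∃; ∃-syntax)
open import Data.Sum using (_⊎_)
open import Relation.Nullary using (¬_)
open import Relation.Binary.PropositionalEquality using (_≡_; _≢_)

-- A k-edge-coloring of K_N: colours of the pairs {i,j}, i ≢ j, given by a
-- symmetric function (diagonal values are never used).
EdgeColoring : ℕ → ℕ → Set
EdgeColoring k N = Fin N → Fin N → Fin k

SymmetricColoring : ∀ {k N} → EdgeColoring k N → Set
SymmetricColoring {N = N} c = ∀ (i j : Fin N) → c i j ≡ c j i

RainbowTriangle : ∀ {k N} → EdgeColoring k N → Set
RainbowTriangle {N = N} c =
  ∃[ i ] ∃[ j ] ∃[ l ] (i ≢ j × j ≢ l × i ≢ l ×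
    c i j ≢ c j l × c j l ≢ c i l × c i j ≢ c i l)

Gallai : ∀ {k N} → EdgeColoring k N → Set
Gallai c = SymmetricColoring c × ¬ RainbowTriangle c

MonoK3 : ∀ {k N} → EdgeColoring k N → Set
MonoK3 {N = N} c =
  ∃[ i ] ∃[ j ] ∃[ l ] (i ≢ j × j ≢ l × i ≢ l × c i j ≡ c j l × c j l ≡ c i l)

IsSubgraph : ∀ {N} → (Fin N → Fin N → Bool) → Set
IsSubgraph {N} E = (∀ (i j : Fin N) → E i j ≡ true → i ≢ j) × (∀ (i j : Fin N) → E i j ≡ E j i)

HomCopyK3 : ∀ {N} → (Fin N → Fin N → Bool) → Set
HomCopyK3 {N} E = Σ (Fin 3 → Fin N) λ φ → (∀ (u v : Fin 3) → u ≢ v → E (φ u) (φ v) ≡ true)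

Monochromatic : ∀ {k N} → EdgeColoring k N → (Fin N → Fin N → Bool) → Set
Monochromatic {k} {N} c E = ∃[ a ] (∀ (i j : Fin N) → E i j ≡ true → c i j ≡ a)

-- monochromatic homomorphic copy of K_3 (equivalently: monochromatic copy of
-- some member of 𝓗(K_3))
MonoHomK3 : ∀ {k N} → EdgeColoring k N → Set
MonoHomK3 {N = N} c = ∃[ E ] (IsSubgraph E × Monochromatic c E × HomCopyK3 E)

IsMin : (ℕ → Set) → ℕ → Set
IsMin P n = P n × (∀ m → P m → n ≤ m)

GRK3Prop : ℕ → ℕ → Set
GRK3Prop k N = ∀ (c : EdgeColoring k N) → Gallai c → MonoK3 c

GRHK3Prop : ℕ → ℕ → Set
GRHK3Prop k N = ∀ (c : EdgeColoring k N) → Gallai c → MonoHomK3 c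

-- colorings of the nonempty subsets of size ≤ 2 of [N]: a vertex colouring
-- cv and a (symmetric) edge colouring c.
GRStarK3Prop : ℕ → ℕ → Set
GRStarK3Prop k N =
  ∀ (cv : Fin N → Fin k) (c : EdgeColoring k N) → SymmetricColoring c →
    RainbowTriangle c ⊎ MonoHomK3 c ⊎
    (∃[ i ] ∃[ j ] (i < j × (c i j ≡ cv i ⊎ c i j ≡ cv j)))

module Submission where

-- All three numbers are least elements of predicates on N.  We show that
-- the three predicates are equivalent for every N and that the last one has
-- a least element; the theorem then follows by transferring minimality.
--
--  * Existence: a Ramsey bound for triangles (via a generalised pigeonhole
--    principle on finite subsets) and decidability of the Gallai–Ramsey
--    property by exhaustive search of colour tables give a least N.
--  * 𝓗(K₃) versus K₃: a homomorphic copy of K₃ in a simple graph is a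
--    triangle, and a triangle is its own homomorphic copy.
--  * GR* ⇒ GR: shift edge colours up by one and colour all vertices 0.
--  * GR ⇒ GR*: a colouring witnessing failure of GR*_k (no rainbow and no
--    monochromatic triangle, no edge coloured like one of its ends) is
--    recoloured so that colour 0 disappears, by recursion on colour-u
--    components (u the colour of a chosen vertex): components are proper
--    subsets seen uniformly from outside, and a transposition of colours
--    realigns the colour to be avoided.

open import Defs
open import Data.Nat using (ℕ; zero; suc; _+_; _*_; _∸_; _≤_; _<_; z≤n; s≤s; _<?_; _≤?_)
open import Data.Nat.Properties
  using (≤-refl; ≤-reflexive; ≤-trans; ≤-pred; <-≤-trans; <⇒≤; <⇒≱; ≮⇒≥; ≰⇒>; n≮n; n≤0⇒n≡0;
         m≤n⇒m<n∨m≡n; +-mono-≤; +-suc; +-comm; module ≤-Reasoning)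
open import Data.Fin using (Fin; zero; suc; _≟_) renaming (_<_ to _<ᶠ_)
open import Data.Fin.Patterns using (0F; 1F; 2F)
import Data.Fin.Properties as FinP
open import Data.Fin.Subset
  using (Subset; _∈_; _∉_; _⊆_; _⊂_; ∣_∣; ⊤; ⁅_⁆; _∪_; _-_; Nonempty; inside; outside)
open import Data.Fin.Subset.Properties
  using (_∈?_; nonempty?; ∈⊤; ∣p∣≤n; ∣⊤∣≡n; x∈⁅x⁆; x∈⁅y⁆⇒x≡y; ∣⁅x⁆∣≡1; ⊆-antisym;
         p⊆q⇒∣p∣≤∣q∣; p⊂q⇒∣p∣<∣q∣; p⊆p∪q; x∈p∪q⁺; x∈p∪q⁻; x∈p⇒∣p-x∣<∣p∣; x∈p∧x≢y⇒x∈p-y)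
open import Data.Fin.Permutation.Components using (transpose; transpose-inverse)
open import Data.Vec using (Vec; []; _∷_; tabulate; lookup; here; there)
open import Data.Vec.Properties using (lookup∘tabulate; lookup⇒[]=; []=⇒lookup)
open import Data.Bool using (Bool; true; if_then_else_)
open import Data.Product using (_×_; _,_; proj₁; proj₂; ∃-syntax)
open import Data.Sum using (_⊎_; inj₁; inj₂)
open import Data.Empty using (⊥)
open import Function.Base using (_∘_)
open import Function.Bundles using (mk⇔)
open import Relation.Nullary using (Dec; yes; no; does; ¬_; contradiction)
open import Relation.Nullary.Decidable
  using (_×-dec_; _⊎-dec_; _→-dec_; ¬?; dec-true; dec-false; does-⇔; map′; decidable-stable)
open import Relation.Unary using (Decidable)
open import Relation.Binary using (tri<; tri≈; tri>)
open import Relation.Binary.PropositionalEquality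

holds : ∀ {A : Set} (a? : Dec A) → does a? ≡ true → A
holds (yes a) _ = a

⟦_⟧ : ∀ {n} {P : Fin n → Set} → Decidable P → Subset n
⟦ P? ⟧ = tabulate (λ x → does (P? x))

∈⟦⟧⁺ : ∀ {n} {P : Fin n → Set} (P? : Decidable P) {x} → P x → x ∈ ⟦ P? ⟧
∈⟦⟧⁺ P? {x} px = lookup⇒[]= x _ (trans (lookup∘tabulate _ x) (dec-true (P? x) px))

∈⟦⟧⁻ : ∀ {n} {P : Fin n → Set} (P? : Decidable P) {x} → x ∈ ⟦ P? ⟧ → P x
∈⟦⟧⁻ P? {x} x∈ = holds (P? x) (trans (sym (lookup∘tabulate _ x)) ([]=⇒lookup x∈))

∣∣-split : ∀ {n} (p : Subset n) {Q : Fin n → Set} (Q? : Decidable Q) →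
  ∣ p ∣ ≡ ∣ ⟦ (λ y → y ∈? p ×-dec Q? y) ⟧ ∣ + ∣ ⟦ (λ y → y ∈? p ×-dec ¬? (Q? y)) ⟧ ∣
∣∣-split [] Q? = refl
∣∣-split (inside ∷ p) Q? with Q? zero | ∣∣-split p (λ y → Q? (suc y))
... | yes _ | ih = cong suc ih
... | no _ | ih = trans (cong suc ih) (sym (+-suc _ _))
∣∣-split (outside ∷ p) Q? = ∣∣-split p (λ y → Q? (suc y))

nonempty : ∀ {n} (p : Subset n) → 0 < ∣ p ∣ → Nonempty p
nonempty (inside ∷ p) _ = zero , here
nonempty (outside ∷ p) h with nonempty p h
... | x , x∈p = suc x , there x∈p

∣∣-pos : ∀ {n} {p : Subset n} {x} → x ∈ p → 0 < ∣ p ∣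
∣∣-pos x∈p = <-≤-trans (s≤s z≤n) (x∈p⇒∣p-x∣<∣p∣ x∈p)

others : ∀ {n} → Subset n → Fin n → Subset n
others W x = ⟦ (λ y → y ∈? W ×-dec ¬? (y ≟ x)) ⟧

others⁻ : ∀ {n} {W : Subset n} {x y} → y ∈ others W x → y ∈ W × y ≢ x
others⁻ {W = W} {x} = ∈⟦⟧⁻ (λ y → y ∈? W ×-dec ¬? (y ≟ x))

∣others∣ : ∀ {n} (W : Subset n) x → ∣ W ∣ ≤ suc ∣ others W x ∣
∣others∣ W x = begin
    ∣ W ∣                                   ≡⟨ ∣∣-split W (λ y → ¬? (y ≟ x)) ⟩
    ∣ others W x ∣ + ∣ ⟦ (λ y → y ∈? W ×-dec ¬? (¬? (y ≟ x))) ⟧ ∣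
                                            ≤⟨ +-mono-≤ ≤-refl at-most-x ⟩
    ∣ others W x ∣ + 1                       ≡⟨ +-comm _ 1 ⟩
    suc ∣ others W x ∣                       ∎
  where
  open ≤-Reasoning
  at-most-x : ∣ ⟦ (λ y → y ∈? W ×-dec ¬? (¬? (y ≟ x))) ⟧ ∣ ≤ 1
  at-most-x = ≤-trans (p⊆q⇒∣p∣≤∣q∣ only-x) (≤-reflexive (∣⁅x⁆∣≡1 x))
    where
    only-x : ⟦ (λ y → y ∈? W ×-dec ¬? (¬? (y ≟ x))) ⟧ ⊆ ⁅ x ⁆
    only-x y∈ = let (_ , ¬y≢x) = ∈⟦⟧⁻ (λ y → y ∈? W ×-dec ¬? (¬? (y ≟ x))) y∈ in
      subst (_∈ ⁅ x ⁆) (sym (decidable-stable (_ ≟ x) ¬y≢x)) (x∈⁅x⁆ x)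

cancel-small-part : ∀ {M J F R} → F < M → M + J < F + R → J < R
cancel-small-part {J = J} {R = R} F<M big with J <? R
... | yes J<R = J<R
... | no J≮R = contradiction (+-mono-≤ (<⇒≤ F<M) (≮⇒≥ J≮R)) (<⇒≱ big)

module _ {n m} (f : Fin n → Fin m) where

  fibre : Subset n → Fin m → Subset n
  fibre U b = ⟦ (λ y → y ∈? U ×-dec f y ≟ b) ⟧

  pigeonhole : ∀ M j (U : Subset n) (B : Subset m) → ∣ B ∣ ≤ j →
    (∀ {y} → y ∈ U → f y ∈ B) → j * M < ∣ U ∣ → ∃[ b ] M ≤ ∣ fibre U b ∣
  pigeonhole M zero U B B≤0 U→B big with nonempty U big
  ... | y , y∈U = contradiction (<-≤-trans (∣∣-pos (U→B y∈U)) B≤0) λ ()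
  pigeonhole M (suc j) U B B≤j U→B big with nonempty U (<-≤-trans (s≤s z≤n) big)
  ... | y , y∈U with M ≤? ∣ fibre U (f y) ∣
  ... | yes large = f y , large
  ... | no small = let (b′ , large) = ih in b′ , ≤-trans large (p⊆q⇒∣p∣≤∣q∣ (fibre-rest⊆fibre b′))
    where
    b : Fin m
    b = f y
    rest : Subset n
    rest = ⟦ (λ z → z ∈? U ×-dec ¬? (f z ≟ b)) ⟧
    rest⁻ : ∀ {z} → z ∈ rest → z ∈ U × f z ≢ b
    rest⁻ = ∈⟦⟧⁻ (λ z → z ∈? U ×-dec ¬? (f z ≟ b))
    fewer-colours : ∣ B - b ∣ ≤ j
    fewer-colours = ≤-pred (<-≤-trans (x∈p⇒∣p-x∣<∣p∣ (U→B y∈U)) B≤j)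
    rest-big : j * M < ∣ rest ∣
    rest-big = cancel-small-part (≰⇒> small) (subst (M + j * M <_) (∣∣-split U (λ z → f z ≟ b)) big)
    ih : ∃[ b′ ] M ≤ ∣ fibre rest b′ ∣
    ih = pigeonhole M j rest (B - b) fewer-colours
           (λ z∈rest → let (z∈U , fz≢b) = rest⁻ z∈rest in x∈p∧x≢y⇒x∈p-y (U→B z∈U) fz≢b) rest-big
    fibre-rest⊆fibre : ∀ b′ → fibre rest b′ ⊆ fibre U b′
    fibre-rest⊆fibre b′ z∈ = let (z∈rest , fz≡b′) = ∈⟦⟧⁻ (λ z → z ∈? rest ×-dec f z ≟ b′) z∈ in
      ∈⟦⟧⁺ (λ z → z ∈? U ×-dec f z ≟ b′) (proj₁ (rest⁻ z∈rest) , fz≡b′)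

ramseyBound : ℕ → ℕ
ramseyBound zero = 2
ramseyBound (suc a) = 2 + suc a * ramseyBound a

ramseyBound-pos : ∀ a → 0 < ramseyBound a
ramseyBound-pos zero = s≤s z≤n
ramseyBound-pos (suc a) = s≤s z≤n

-- Induction on a: some vertex x
-- of W has R(a) neighbours in one colour b; among them either an edge has
-- colour b (a triangle with x) or only the colours of A - b occur.
ramsey : ∀ {N m} (c : EdgeColoring m N) a (W : Subset N) (A : Subset m) → ∣ A ∣ ≤ a →
  (∀ {x y} → x ∈ W → y ∈ W → x ≢ y → c x y ∈ A) → ramseyBound a ≤ ∣ W ∣ → MonoK3 c
ramsey c zero W A A≤0 colours big with nonempty W (<-≤-trans (s≤s z≤n) big)
... | x , x∈W with nonempty (others W x) (≤-pred (≤-trans big (∣others∣ W x)))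
... | y , y∈ = let (y∈W , y≢x) = others⁻ y∈ in
  contradiction (<-≤-trans (∣∣-pos (colours x∈W y∈W (λ x≡y → y≢x (sym x≡y)))) A≤0) λ ()
ramsey {N} {m} c (suc a) W A A≤a colours big = conclude edge-of-colour?
  where
  centre : Nonempty W
  centre = nonempty W (<-≤-trans (s≤s z≤n) big)
  x : Fin N
  x = proj₁ centre
  x∈W : x ∈ W
  x∈W = proj₂ centre
  U : Subset N
  U = others W x
  colours-at-x : ∀ {y} → y ∈ U → c x y ∈ A
  colours-at-x y∈U = let (y∈W , y≢x) = others⁻ y∈U in colours x∈W y∈W (λ x≡y → y≢x (sym x≡y))
  ph : ∃[ b ] ramseyBound a ≤ ∣ fibre (c x) U b ∣
  ph = pigeonhole (c x) (ramseyBound a) (suc a) U A A≤a colours-at-x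
         (≤-pred (≤-trans big (∣others∣ W x)))
  b : Fin m
  b = proj₁ ph
  W′ : Subset N
  W′ = fibre (c x) U b
  W′⁻ : ∀ {y} → y ∈ W′ → y ∈ U × c x y ≡ b
  W′⁻ = ∈⟦⟧⁻ (λ y → y ∈? U ×-dec c x y ≟ b)
  edge-of-colour? : Dec (∃[ y ] ∃[ z ] (y ∈ W′ × z ∈ W′ × y ≢ z × c y z ≡ b))
  edge-of-colour? = FinP.any? λ y → FinP.any? λ z → y ∈? W′ ×-dec z ∈? W′ ×-dec ¬? (y ≟ z) ×-dec c y z ≟ b
  conclude : Dec (∃[ y ] ∃[ z ] (y ∈ W′ × z ∈ W′ × y ≢ z × c y z ≡ b)) → MonoK3 c
  conclude (yes (y , z , y∈ , z∈ , y≢z , cyz≡b)) =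
    let (y∈U , cxy≡b) = W′⁻ y∈ ; (z∈U , cxz≡b) = W′⁻ z∈ in
    x , y , z , (λ x≡y → proj₂ (others⁻ y∈U) (sym x≡y)) , y≢z , (λ x≡z → proj₂ (others⁻ z∈U) (sym x≡z)) ,
    trans cxy≡b (sym cyz≡b) , trans cyz≡b (sym cxz≡b)
  conclude (no none) = ramsey c a W′ (A - b) fewer-colours colours-in-W′ (proj₂ ph)
    where
    witness : Nonempty W′
    witness = nonempty W′ (<-≤-trans (ramseyBound-pos a) (proj₂ ph))
    b∈A : b ∈ A
    b∈A = let (y∈U , cxy≡b) = W′⁻ (proj₂ witness) in subst (_∈ A) cxy≡b (colours-at-x y∈U)
    fewer-colours : ∣ A - b ∣ ≤ a
    fewer-colours = ≤-pred (<-≤-trans (x∈p⇒∣p-x∣<∣p∣ b∈A) A≤a)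
    in-W : ∀ {y} → y ∈ W′ → y ∈ W
    in-W y∈ = proj₁ (others⁻ (proj₁ (W′⁻ y∈)))
    colours-in-W′ : ∀ {y z} → y ∈ W′ → z ∈ W′ → y ≢ z → c y z ∈ A - b
    colours-in-W′ y∈ z∈ y≢z =
      x∈p∧x≢y⇒x∈p-y (colours (in-W y∈) (in-W z∈) y≢z) (λ cyz≡b → none (_ , _ , y∈ , z∈ , y≢z , cyz≡b))

grK3-bounded : ∀ m → GRK3Prop m (ramseyBound m)
grK3-bounded m c _ = ramsey c m ⊤ ⊤ (∣p∣≤n ⊤) (λ _ _ _ → ∈⊤)
  (≤-reflexive (sym (∣⊤∣≡n (ramseyBound m))))

least : ∀ {P : ℕ → Set} → (∀ n → Dec (P n)) → ∀ {B} → P B → ∃[ N ] IsMin P N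
least {P} P? {B} pB = conclude (search B)
  where
  search : ∀ n → (∃[ N ] IsMin P N) ⊎ (∀ m → m ≤ n → ¬ P m)
  search zero with P? zero
  ... | yes p0 = inj₁ (zero , p0 , λ _ _ → z≤n)
  ... | no ¬p0 = inj₂ λ m m≤0 → subst (λ k → ¬ P k) (sym (n≤0⇒n≡0 m≤0)) ¬p0
  search (suc n) with search n
  ... | inj₁ found = inj₁ found
  ... | inj₂ none with P? (suc n)
  ...   | yes p = inj₁ (suc n , p , λ m pm → ≰⇒> λ m≤n → none m m≤n pm)
  ...   | no ¬p = inj₂ λ m m≤1+n → below-or-at m (m≤n⇒m<n∨m≡n m≤1+n)
    where
    below-or-at : ∀ m → m < suc n ⊎ m ≡ suc n → ¬ P m
    below-or-at m (inj₁ m<1+n) = none m (≤-pred m<1+n)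
    below-or-at m (inj₂ refl) = ¬p
  conclude : (∃[ N ] IsMin P N) ⊎ (∀ m → m ≤ B → ¬ P m) → ∃[ N ] IsMin P N
  conclude (inj₁ found) = found
  conclude (inj₂ none) = contradiction pB (none B ≤-refl)

Searchable : Set → Set₁
Searchable A = ∀ {P : A → Set} → Decidable P → Dec (∀ a → P a)

vec-searchable : ∀ {A} → Searchable A → ∀ n → Searchable (Vec A n)
vec-searchable S zero P? = map′ (λ p → λ { [] → p }) (λ h → h []) (P? [])
vec-searchable S (suc n) P? =
  map′ (λ h → λ { (a ∷ w) → h a w }) (λ h a w → h (a ∷ w))
       (S λ a → vec-searchable S n λ w → P? (a ∷ w))

fromTable : ∀ {k N} → Vec (Vec (Fin k) N) N → EdgeColoring k N
fromTable t i j = lookup (lookup t i) j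

toTable : ∀ {k N} → EdgeColoring k N → Vec (Vec (Fin k) N) N
toTable c = tabulate λ i → tabulate (c i)

fromTable-toTable : ∀ {k N} (c : EdgeColoring k N) i j → fromTable (toTable c) i j ≡ c i j
fromTable-toTable c i j = trans (cong (λ row → lookup row j) (lookup∘tabulate _ i)) (lookup∘tabulate (c i) j)

_≗₂_ : ∀ {k N} → EdgeColoring k N → EdgeColoring k N → Set
c ≗₂ c′ = ∀ i j → c i j ≡ c′ i j

gallai-resp : ∀ {k N} {c c′ : EdgeColoring k N} → c ≗₂ c′ → Gallai c → Gallai c′
gallai-resp {c = c} {c′} e (sym-c , no-rainbow) =
  (λ i j → trans (sym (e i j)) (trans (sym-c i j) (e j i))) ,
  λ (i , j , l , i≢j , j≢l , i≢l , p , q , r) → no-rainbow (i , j , l , i≢j , j≢l , i≢l ,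
    (λ s → p (trans (sym (e i j)) (trans s (e j l)))) ,
    (λ s → q (trans (sym (e j l)) (trans s (e i l)))) ,
    (λ s → r (trans (sym (e i j)) (trans s (e i l)))))

mono-resp : ∀ {k N} {c c′ : EdgeColoring k N} → c ≗₂ c′ → MonoK3 c → MonoK3 c′
mono-resp e (i , j , l , i≢j , j≢l , i≢l , p , q) = i , j , l , i≢j , j≢l , i≢l ,
  trans (sym (e i j)) (trans p (e j l)) , trans (sym (e j l)) (trans q (e i l))

rainbow? : ∀ {k N} (c : EdgeColoring k N) → Dec (RainbowTriangle c)
rainbow? c = FinP.any? λ i → FinP.any? λ j → FinP.any? λ l →
  ¬? (i ≟ j) ×-dec ¬? (j ≟ l) ×-dec ¬? (i ≟ l) ×-dec
  ¬? (c i j ≟ c j l) ×-dec ¬? (c j l ≟ c i l) ×-dec ¬? (c i j ≟ c i l)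

monoK3? : ∀ {k N} (c : EdgeColoring k N) → Dec (MonoK3 c)
monoK3? c = FinP.any? λ i → FinP.any? λ j → FinP.any? λ l →
  ¬? (i ≟ j) ×-dec ¬? (j ≟ l) ×-dec ¬? (i ≟ l) ×-dec c i j ≟ c j l ×-dec c j l ≟ c i l

gallai? : ∀ {k N} (c : EdgeColoring k N) → Dec (Gallai c)
gallai? c = (FinP.all? λ i → FinP.all? λ j → c i j ≟ c j i) ×-dec ¬? (rainbow? c)

-- Hence the Gallai–Ramsey property is decidable: search all colour tables.
grK3? : ∀ m N → Dec (GRK3Prop m N)
grK3? m N = map′ from-tables to-tables
  (vec-searchable (vec-searchable FinP.all? N) N λ t → gallai? (fromTable t) →-dec monoK3? (fromTable t))
  where
  from-tables : (∀ t → Gallai (fromTable t) → MonoK3 (fromTable t)) → GRK3Prop m N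
  from-tables h c g = mono-resp (fromTable-toTable c)
    (h (toTable c) (gallai-resp (λ i j → sym (fromTable-toTable c i j)) g))
  to-tables : GRK3Prop m N → ∀ t → Gallai (fromTable t) → MonoK3 (fromTable t)
  to-tables h t = h (fromTable t)

-- A homomorphic copy of K₃ inside a simple graph is a genuine triangle,
-- since the edge relation is irreflexive.
hom→mono : ∀ {k N} (c : EdgeColoring k N) → MonoHomK3 c → MonoK3 c
hom→mono c (E , (irreflexive , _) , (a , mono) , (φ , hom)) =
  φ 0F , φ 1F , φ 2F ,
  irreflexive _ _ e01 , irreflexive _ _ e12 , irreflexive _ _ e02 ,
  trans (mono _ _ e01) (sym (mono _ _ e12)) , trans (mono _ _ e12) (sym (mono _ _ e02))
  where
  e01 : E (φ 0F) (φ 1F) ≡ true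
  e01 = hom 0F 1F λ ()
  e12 : E (φ 1F) (φ 2F) ≡ true
  e12 = hom 1F 2F λ ()
  e02 : E (φ 0F) (φ 2F) ≡ true
  e02 = hom 0F 2F λ ()

module TriangleImage {k N} (c : EdgeColoring k N) (sym-c : SymmetricColoring c) {i j l : Fin N}
  (i≢j : i ≢ j) (j≢l : j ≢ l) (i≢l : i ≢ l) (cij≡cjl : c i j ≡ c j l) (cjl≡cil : c j l ≡ c i l) where

  φ : Fin 3 → Fin N
  φ 0F = i
  φ 1F = j
  φ 2F = l

  φ-injective : ∀ u v → u ≢ v → φ u ≢ φ v
  φ-injective 0F 0F u≢v = contradiction refl u≢v
  φ-injective 0F 1F _ = i≢j
  φ-injective 0F 2F _ = i≢l
  φ-injective 1F 0F _ = i≢j ∘ sym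
  φ-injective 1F 1F u≢v = contradiction refl u≢v
  φ-injective 1F 2F _ = j≢l
  φ-injective 2F 0F _ = i≢l ∘ sym
  φ-injective 2F 1F _ = j≢l ∘ sym
  φ-injective 2F 2F u≢v = contradiction refl u≢v

  φ-mono : ∀ u v → u ≢ v → c (φ u) (φ v) ≡ c i j
  φ-mono 0F 0F u≢v = contradiction refl u≢v
  φ-mono 0F 1F _ = refl
  φ-mono 0F 2F _ = trans (sym cjl≡cil) (sym cij≡cjl)
  φ-mono 1F 0F _ = sym-c j i
  φ-mono 1F 1F u≢v = contradiction refl u≢v
  φ-mono 1F 2F _ = sym cij≡cjl
  φ-mono 2F 0F _ = trans (sym-c l i) (φ-mono 0F 2F λ ())
  φ-mono 2F 1F _ = trans (sym-c l j) (sym cij≡cjl)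
  φ-mono 2F 2F u≢v = contradiction refl u≢v

  Edge : Fin N → Fin N → Set
  Edge x y = ∃[ u ] ∃[ v ] (u ≢ v × φ u ≡ x × φ v ≡ y)

  edge? : ∀ x y → Dec (Edge x y)
  edge? x y = FinP.any? λ u → FinP.any? λ v → ¬? (u ≟ v) ×-dec φ u ≟ x ×-dec φ v ≟ y

  E : Fin N → Fin N → Bool
  E x y = does (edge? x y)

  irreflexive : ∀ x y → E x y ≡ true → x ≢ y
  irreflexive x y e x≡y with holds (edge? x y) e
  ... | u , v , u≢v , refl , refl = φ-injective u v u≢v x≡y

  symmetric : ∀ x y → E x y ≡ E y x
  symmetric x y = does-⇔ (mk⇔ flip flip) (edge? x y) (edge? y x)
    where
    flip : ∀ {x y} → Edge x y → Edge y x
    flip (u , v , u≢v , refl , refl) = v , u , u≢v ∘ sym , refl , refl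

  mono : ∀ x y → E x y ≡ true → c x y ≡ c i j
  mono x y e with holds (edge? x y) e
  ... | u , v , u≢v , refl , refl = φ-mono u v u≢v

  copy : MonoHomK3 c
  copy = E , (irreflexive , symmetric) , (c i j , mono) ,
    (φ , λ u v u≢v → dec-true (edge? (φ u) (φ v)) (u , v , u≢v , refl , refl))

mono→hom : ∀ {k N} (c : EdgeColoring k N) → SymmetricColoring c → MonoK3 c → MonoHomK3 c
mono→hom c sym-c (_ , _ , _ , i≢j , j≢l , i≢l , cij≡cjl , cjl≡cil) =
  TriangleImage.copy c sym-c i≢j j≢l i≢l cij≡cjl cjl≡cil

grH→gr : ∀ m N → GRHK3Prop m N → GRK3Prop m N
grH→gr m N h c g = hom→mono c (h c g)

gr→grH : ∀ m N → GRK3Prop m N → GRHK3Prop m N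
gr→grH m N h c g = mono→hom c (proj₁ g) (h c g)

star→gr : ∀ m N → GRStarK3Prop (suc m) N → GRK3Prop m N
star→gr m N h c (sym-c , no-rainbow) with h (λ _ → zero) (λ i j → suc (c i j)) (λ i j → cong suc (sym-c i j))
... | inj₁ (i , j , l , i≢j , j≢l , i≢l , p , q , r) =
  contradiction (i , j , l , i≢j , j≢l , i≢l , p ∘ cong suc , q ∘ cong suc , r ∘ cong suc) no-rainbow
... | inj₂ (inj₁ copy) with hom→mono _ copy
...   | i , j , l , i≢j , j≢l , i≢l , p , q = i , j , l , i≢j , j≢l , i≢l , FinP.suc-injective p , FinP.suc-injective q
star→gr m N h c _ | inj₂ (inj₂ (_ , _ , _ , inj₁ ()))
star→gr m N h c _ | inj₂ (inj₂ (_ , _ , _ , inj₂ ()))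

Admissible : ∀ {k} → Fin k → Fin k → Fin k → Set
Admissible A B D = (A ≡ B ⊎ B ≡ D ⊎ A ≡ D) × ¬ (A ≡ B × B ≡ D)

module _ {k} {A B D : Fin k} where

  adm-swap₂₃ : Admissible A B D → Admissible A D B
  adm-swap₂₃ (two-equal , not-mono) = swap two-equal , λ (A≡D , D≡B) → not-mono (trans A≡D D≡B , sym D≡B)
    where
    swap : A ≡ B ⊎ B ≡ D ⊎ A ≡ D → A ≡ D ⊎ D ≡ B ⊎ A ≡ B
    swap (inj₁ A≡B) = inj₂ (inj₂ A≡B)
    swap (inj₂ (inj₁ B≡D)) = inj₂ (inj₁ (sym B≡D))
    swap (inj₂ (inj₂ A≡D)) = inj₁ A≡D

  adm-swap₁₃ : Admissible A B D → Admissible D B A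
  adm-swap₁₃ (two-equal , not-mono) = swap two-equal , λ (D≡B , B≡A) → not-mono (sym B≡A , sym D≡B)
    where
    swap : A ≡ B ⊎ B ≡ D ⊎ A ≡ D → D ≡ B ⊎ B ≡ A ⊎ D ≡ A
    swap (inj₁ A≡B) = inj₂ (inj₁ (sym A≡B))
    swap (inj₂ (inj₁ B≡D)) = inj₁ (sym B≡D)
    swap (inj₂ (inj₂ A≡D)) = inj₂ (inj₂ (sym A≡D))

  adm-≡ : ∀ {A′ B′ D′} → A ≡ A′ → B ≡ B′ → D ≡ D′ → Admissible A′ B′ D′ → Admissible A B D
  adm-≡ refl refl refl adm = adm

  adm-isosceles : A ≢ B → B ≡ D → Admissible A B D
  adm-isosceles A≢B B≡D = inj₂ (inj₁ B≡D) , λ (A≡B , _) → A≢B A≡B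

module _ {k} (t u : Fin k) where

  transpose-injective : ∀ {a b} → transpose t u a ≡ transpose t u b → a ≡ b
  transpose-injective {a} {b} e =
    trans (sym (transpose-inverse u t)) (trans (cong (transpose u t) e) (transpose-inverse u t))

  transpose-to-t : ∀ {a} → transpose t u a ≡ t → a ≡ u
  transpose-to-t e = transpose-injective (trans e (sym u↦t))
    where
    u↦t : transpose t u u ≡ t
    u↦t with u ≟ t
    ... | yes u≡t = u≡t
    ... | no _ rewrite dec-true (u ≟ u) refl = refl

  transpose-other : ∀ a → a ≢ u → transpose t u a ≡ a ⊎ transpose t u a ≡ u
  transpose-other a a≢u with a ≟ t
  ... | yes _ = inj₂ refl
  ... | no _ rewrite dec-false (a ≟ u) a≢u = inj₁ refl

-- Saturating a set under an inflationary operator F on subsets of Fin n: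
-- since sizes are bounded by n, n+1 rounds reach an F-closed set.
module Saturation {n} (F : Subset n → Subset n) (inflationary : ∀ R → R ⊆ F R) where

  stage : Subset n → ℕ → Subset n
  stage R zero = R
  stage R (suc i) = F (stage R i)

  saturate : Subset n → Subset n
  saturate R = stage R (suc n)

  grows-or-closed : ∀ R → F R ⊆ R ⊎ ∣ R ∣ < ∣ F R ∣
  grows-or-closed R with FinP.any? (λ x → x ∈? F R ×-dec ¬? (x ∈? R))
  ... | yes (x , x∈FR , x∉R) = inj₂ (p⊂q⇒∣p∣<∣q∣ (inflationary R , x , x∈FR , x∉R))
  ... | no none = inj₁ λ {x} x∈FR → decidable-stable (x ∈? R) λ x∉R → none (x , x∈FR , x∉R)

  -- a closed set is a fixed point of F, so it stays closed
  closed-stays : ∀ {R} → F R ⊆ R → F (F R) ⊆ F R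
  closed-stays {R} FR⊆R = subst (λ S → F S ⊆ S) (sym (⊆-antisym FR⊆R (inflationary R))) FR⊆R

  progress : ∀ R i → F (stage R i) ⊆ stage R i ⊎ i ≤ ∣ stage R i ∣
  progress R zero = inj₂ z≤n
  progress R (suc i) with progress R i
  ... | inj₁ closed = inj₁ (closed-stays closed)
  ... | inj₂ i≤ with grows-or-closed (stage R i)
  ...   | inj₁ closed = inj₁ (closed-stays closed)
  ...   | inj₂ grows = inj₂ (<-≤-trans (s≤s i≤) grows)

  saturate-closed : ∀ R → F (saturate R) ⊆ saturate R
  saturate-closed R with progress R (suc n)
  ... | inj₁ closed = closed
  ... | inj₂ too-big = contradiction (≤-trans too-big (∣p∣≤n (saturate R))) (n≮n n)

  ⊆-saturate : ∀ R → R ⊆ saturate R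
  ⊆-saturate R = go (suc n)
    where
    go : ∀ i → R ⊆ stage R i
    go zero x∈R = x∈R
    go (suc i) x∈R = inflationary _ (go i x∈R)

  saturate-ind : ∀ (Q : Fin n → Set) R → (∀ {x} → x ∈ R → Q x) →
    (∀ S → (∀ {x} → x ∈ S → Q x) → ∀ {x} → x ∈ F S → Q x) → ∀ {x} → x ∈ saturate R → Q x
  saturate-ind Q R base step = go (suc n)
    where
    go : ∀ i {x} → x ∈ stage R i → Q x
    go zero = base
    go (suc i) = step (stage R i) (go i)

-- The colour-u component C x of x inside W: the vertices of W reachable
-- from x along edges of colour u.
module Components {N k} (c : EdgeColoring k N) (c-sym : SymmetricColoring c) (u : Fin k) (W : Subset N) where

  extend : Subset N → Subset N
  extend R = R ∪ ⟦ joined R ⟧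
    where
    joined : ∀ R y → Dec (y ∈ W × ∃[ z ] (z ∈ R × c z y ≡ u))
    joined R y = y ∈? W ×-dec FinP.any? λ z → z ∈? R ×-dec c z y ≟ u

  open Saturation extend (λ R → p⊆p∪q _)

  C : Fin N → Subset N
  C x = saturate ⁅ x ⁆

  self : ∀ x → x ∈ C x
  self x = ⊆-saturate ⁅ x ⁆ (x∈⁅x⁆ x)

  closed : ∀ {x y z} → y ∈ C x → z ∈ W → c y z ≡ u → z ∈ C x
  closed {x} {y} {z} y∈ z∈W cyz≡u = saturate-closed ⁅ x ⁆
    (x∈p∪q⁺ (inj₂ (∈⟦⟧⁺ (λ y → y ∈? W ×-dec FinP.any? λ z → z ∈? C x ×-dec c z y ≟ u) (z∈W , y , y∈ , cyz≡u))))

  component-ind : ∀ (Q : Fin N → Set) {x} → Q x →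
    (∀ {y z} → z ∈ C x → Q z → y ∈ W → c z y ≡ u → Q y) → ∀ {y} → y ∈ C x → Q y
  component-ind Q {x} Qx step y∈ = proj₂ (saturate-ind (λ y → y ∈ C x × Q y) ⁅ x ⁆ base step′ y∈)
    where
    base : ∀ {y} → y ∈ ⁅ x ⁆ → y ∈ C x × Q y
    base y∈⁅x⁆ rewrite x∈⁅y⁆⇒x≡y x y∈⁅x⁆ = self x , Qx
    step′ : ∀ S → (∀ {y} → y ∈ S → y ∈ C x × Q y) → ∀ {y} → y ∈ extend S → y ∈ C x × Q y
    step′ S hyp {y} y∈ with x∈p∪q⁻ S _ y∈
    ... | inj₁ y∈S = hyp y∈S
    ... | inj₂ y∈new with ∈⟦⟧⁻ (λ y → y ∈? W ×-dec FinP.any? λ z → z ∈? S ×-dec c z y ≟ u) y∈new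
    ...   | y∈W , z , z∈S , czy≡u = let (z∈C , Qz) = hyp z∈S in closed z∈C y∈W czy≡u , step z∈C Qz y∈W czy≡u

  C⊆W : ∀ {x} → x ∈ W → C x ⊆ W
  C⊆W x∈W = component-ind (_∈ W) x∈W λ _ _ y∈W _ → y∈W

  C-sub : ∀ {x y} → y ∈ C x → C y ⊆ C x
  C-sub y∈ = component-ind (_∈ C _) y∈ λ _ z∈ y∈W czy≡u → closed z∈ y∈W czy≡u

  C-symm : ∀ {x y} → x ∈ W → y ∈ C x → x ∈ C y
  C-symm {x} x∈W = component-ind (λ p → x ∈ C p) (self x) step
    where
    step : ∀ {p w} → w ∈ C x → x ∈ C w → p ∈ W → c w p ≡ u → x ∈ C p
    step {p} {w} w∈ x∈Cw p∈W cwp≡u = C-sub w∈Cp x∈Cw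
      where
      w∈Cp : w ∈ C p
      w∈Cp = closed (self p) (C⊆W x∈W w∈) (trans (c-sym p w) cwp≡u)

  C-eq : ∀ {x y} → x ∈ W → y ∈ C x → C y ≡ C x
  C-eq x∈W y∈ = ⊆-antisym (C-sub y∈) (C-sub (C-symm x∈W y∈))

  C-outside-symm : ∀ {x y} → y ∈ W → y ∉ C x → x ∉ C y
  C-outside-symm y∈W y∉Cx x∈Cy = y∉Cx (C-symm y∈W x∈Cy)

-- We recolour the edges inside any vertex set W
-- so that all triangles stay admissible, a prescribed colour t disappears,
-- and only colours already used on W occur.
module Elimination {N k} (cv : Fin N → Fin k) (c : EdgeColoring k N)
  (c-sym : SymmetricColoring c)
  (c-adm : ∀ {x y z} → x ≢ y → y ≢ z → x ≢ z → Admissible (c x y) (c y z) (c x z))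
  (c-proper : ∀ {x y} → x ≢ y → c x y ≢ cv x) where

  Used : Subset N → Fin k → Set
  Used W b = (∃[ y ] (y ∈ W × cv y ≡ b)) ⊎ (∃[ y ] ∃[ y′ ] (y ∈ W × y′ ∈ W × y ≢ y′ × c y y′ ≡ b))

  Used-mono : ∀ {S W} → S ⊆ W → ∀ {b} → Used S b → Used W b
  Used-mono S⊆W (inj₁ (y , y∈ , e)) = inj₁ (y , S⊆W y∈ , e)
  Used-mono S⊆W (inj₂ (y , y′ , y∈ , y′∈ , y≢y′ , e)) = inj₂ (y , y′ , S⊆W y∈ , S⊆W y′∈ , y≢y′ , e)

  record Valid (d : EdgeColoring k N) (W : Subset N) (t : Fin k) : Set where
    field
      symmetric : ∀ {x y} → x ∈ W → y ∈ W → d x y ≡ d y x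
      admissible : ∀ {x y z} → x ∈ W → y ∈ W → z ∈ W → x ≢ y → y ≢ z → x ≢ z →
        Admissible (d x y) (d y z) (d x z)
      avoids : ∀ {x y} → x ∈ W → y ∈ W → x ≢ y → d x y ≢ t
      uses : ∀ {x y} → x ∈ W → y ∈ W → x ≢ y → Used W (d x y)

  valid-empty : ∀ d W t → (∀ x → x ∉ W) → Valid d W t
  valid-empty d W t empty = record
    { symmetric = λ x∈ _ → contradiction x∈ (empty _)
    ; admissible = λ x∈ _ _ _ _ _ → contradiction x∈ (empty _)
    ; avoids = λ x∈ _ _ → contradiction x∈ (empty _)
    ; uses = λ x∈ _ _ → contradiction x∈ (empty _) }

  valid-transpose : ∀ {d W} t u → Used W u → Valid d W u → Valid (λ x y → transpose t u (d x y)) W t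
  valid-transpose {d} {W} t u u-used valid = record
    { symmetric = λ x∈ y∈ → cong (transpose t u) (symmetric x∈ y∈)
    ; admissible = λ x∈ y∈ z∈ x≢y y≢z x≢z → let (two-equal , not-mono) = admissible x∈ y∈ z∈ x≢y y≢z x≢z in
        map-two-equal two-equal ,
        λ (p , q) → not-mono (transpose-injective t u p , transpose-injective t u q)
    ; avoids = λ x∈ y∈ x≢y e → avoids x∈ y∈ x≢y (transpose-to-t t u e)
    ; uses = λ x∈ y∈ x≢y → used-after (uses x∈ y∈ x≢y) (transpose-other t u _ (avoids x∈ y∈ x≢y)) }
    where
    open Valid valid
    τ : Fin k → Fin k
    τ = transpose t u
    map-two-equal : ∀ {A B D} → A ≡ B ⊎ B ≡ D ⊎ A ≡ D → τ A ≡ τ B ⊎ τ B ≡ τ D ⊎ τ A ≡ τ D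
    map-two-equal (inj₁ e) = inj₁ (cong τ e)
    map-two-equal (inj₂ (inj₁ e)) = inj₂ (inj₁ (cong τ e))
    map-two-equal (inj₂ (inj₂ e)) = inj₂ (inj₂ (cong τ e))
    used-after : ∀ {a} → Used W a → τ a ≡ a ⊎ τ a ≡ u → Used W (τ a)
    used-after a-used (inj₁ e) = subst (Used W) (sym e) a-used
    used-after _ (inj₂ e) = subst (Used W) (sym e) u-used

  module ComponentFacts (u : Fin k) (W : Subset N) where
    open Components c c-sym u W public

    uniform : ∀ {x z} → z ∈ W → z ∉ C x → ∀ {p} → p ∈ C x → c z p ≡ c z x
    uniform {x} {z} z∈W z∉ = component-ind (λ p → c z p ≡ c z x) refl step
      where
      step : ∀ {p w} → w ∈ C x → c z w ≡ c z x → p ∈ W → c w p ≡ u → c z p ≡ c z x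
      step {p} {w} w∈ czw≡czx p∈W cwp≡u with w ≟ p
      ... | yes refl = czw≡czx
      ... | no w≢p = trans (c-sym z p) (trans (sides-at-z (c-adm w≢p p≢z w≢z)) (trans (c-sym w z) czw≡czx))
        where
        p∈ : p ∈ C x
        p∈ = closed w∈ p∈W cwp≡u
        p≢z : p ≢ z
        p≢z refl = z∉ p∈
        w≢z : w ≢ z
        w≢z refl = z∉ w∈
        -- neither side at z has colour u (z would join C x), so they agree
        sides-at-z : Admissible (c w p) (c p z) (c w z) → c p z ≡ c w z
        sides-at-z (inj₁ cwp≡cpz , _) = contradiction (closed p∈ z∈W (trans (sym cwp≡cpz) cwp≡u)) z∉
        sides-at-z (inj₂ (inj₁ cpz≡cwz) , _) = cpz≡cwz
        sides-at-z (inj₂ (inj₂ cwp≡cwz) , _) = contradiction (closed w∈ z∈W (trans (sym cwp≡cwz) cwp≡u)) z∉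

    not-used : ∀ {x z} → z ∈ W → z ∉ C x → ∀ {b} → Used (C x) b → b ≢ c z x
    not-used {x} {z} z∈W z∉ (inj₁ (y , y∈ , cvy≡b)) b≡czx =
      c-proper (λ { refl → z∉ y∈ }) (trans (to-z y∈) (trans (sym b≡czx) (sym cvy≡b)))
      where
      to-z : ∀ {p} → p ∈ C x → c p z ≡ c z x
      to-z p∈ = trans (c-sym _ z) (uniform z∈W z∉ p∈)
    not-used {x} {z} z∈W z∉ (inj₂ (y , y′ , y∈ , y′∈ , y≢y′ , cyy′≡b)) b≡czx =
      proj₂ (c-adm y≢y′ (λ { refl → z∉ y′∈ }) (λ { refl → z∉ y∈ }))
        (trans cyy′≡b (trans b≡czx (sym (to-z y′∈))) , trans (to-z y′∈) (sym (to-z y∈)))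
      where
      to-z : ∀ {p} → p ∈ C x → c p z ≡ c z x
      to-z p∈ = trans (c-sym _ z) (uniform z∈W z∉ p∈)

    -- a vertex v of W whose own colour is u has no u-edges, so it forms a
    -- component on its own; every component is then a proper subset of W
    module _ {v} (v∈W : v ∈ W) (cv≡u : cv v ≡ u) where

      no-u-edge : ∀ {w} → w ≢ v → c w v ≢ u
      no-u-edge w≢v cwv≡u = c-proper (w≢v ∘ sym) (trans (c-sym _ _) (trans cwv≡u (sym cv≡u)))

      C-v : ∀ {y} → y ∈ C v → y ≡ v
      C-v = component-ind (_≡ v) refl step
        where
        step : ∀ {p w} → w ∈ C v → w ≡ v → p ∈ W → c w p ≡ u → p ≡ v
        step {p} _ refl _ cvp≡u with p ≟ v
        ... | yes p≡v = p≡v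
        ... | no p≢v = contradiction (trans (c-sym p v) cvp≡u) (no-u-edge p≢v)

      v∉C : ∀ {x} → x ≢ v → v ∉ C x
      v∉C x≢v v∈ = component-ind (_≢ v) x≢v (λ _ w≢v _ cwp≡u → λ { refl → no-u-edge w≢v cwp≡u }) v∈ refl

      C⊂W : ∀ {x y} → x ∈ W → y ∈ W → x ≢ y → C x ⊂ W
      C⊂W {x} {y} x∈W y∈W x≢y with x ≟ v
      ... | yes refl = C⊆W x∈W , y , y∈W , λ y∈ → x≢y (sym (C-v y∈))
      ... | no x≢v = C⊆W x∈W , v , v∈W , v∉C x≢v

  merge : (Subset N → Fin k → EdgeColoring k N) → Subset N → Fin k → EdgeColoring k N
  merge rec W u x y = if does (y ∈? C x) then rec (C x) u x y else c x y
    where open Components c c-sym u W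

  module MergeValid (rec : Subset N → Fin k → EdgeColoring k N) (W : Subset N) {v} (v∈W : v ∈ W)
    (rec-valid : ∀ S t → ∣ S ∣ < ∣ W ∣ → Valid (rec S t) S t) where

    u : Fin k
    u = cv v
    open ComponentFacts u W
    d : EdgeColoring k N
    d = merge rec W u

    d-in : ∀ {x y} → y ∈ C x → d x y ≡ rec (C x) u x y
    d-in {x} {y} y∈ rewrite dec-true (y ∈? C x) y∈ = refl

    d-out : ∀ {x y} → y ∉ C x → d x y ≡ c x y
    d-out {x} {y} y∉ rewrite dec-false (y ∈? C x) y∉ = refl

    d-within : ∀ {x p q} → x ∈ W → p ∈ C x → q ∈ C x → d p q ≡ rec (C x) u p q
    d-within {x} {p} {q} x∈W p∈ q∈ =
      trans (d-in (subst (q ∈_) (sym (C-eq x∈W p∈)) q∈)) (cong (λ S → rec S u p q) (C-eq x∈W p∈))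

    -- components are proper subsets of W, so rec is valid on them
    valid-in : ∀ {x y} → x ∈ W → y ∈ W → x ≢ y → Valid (rec (C x) u) (C x) u
    valid-in {x} x∈W y∈W x≢y = rec-valid (C x) u (p⊂q⇒∣p∣<∣q∣ (C⊂W v∈W refl x∈W y∈W x≢y))

    d-symmetric : ∀ {x y} → x ∈ W → y ∈ W → d x y ≡ d y x
    d-symmetric {x} {y} x∈W y∈W with x ≟ y
    ... | yes refl = refl
    ... | no x≢y = by-component (y ∈? C x)
      where
      by-component : Dec (y ∈ C x) → d x y ≡ d y x
      by-component (yes y∈) = trans (d-in y∈)
        (trans (Valid.symmetric (valid-in x∈W y∈W x≢y) (self x) y∈) (sym (d-within x∈W y∈ (self x))))
      by-component (no y∉) = trans (d-out y∉) (trans (c-sym x y) (sym (d-out (C-outside-symm y∈W y∉))))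

    -- a triangle with p, q in one component and s outside it is isosceles:
    -- both edges at s carry the colour seen by s, the third a used colour of C p
    two-in-one : ∀ {p q s} → p ∈ W → q ∈ C p → p ≢ q → s ∈ W → s ∉ C p →
      Admissible (d p q) (d q s) (d p s)
    two-in-one {p} {q} {s} p∈W q∈ p≢q s∈W s∉ = adm-isosceles A≢B B≡D
      where
      open ≡-Reasoning
      D≡csp : d p s ≡ c s p
      D≡csp = trans (d-out s∉) (c-sym p s)
      B≡D : d q s ≡ d p s
      B≡D = begin
        d q s  ≡⟨ d-out (subst (s ∉_) (sym (C-eq p∈W q∈)) s∉) ⟩
        c q s  ≡⟨ c-sym q s ⟩
        c s q  ≡⟨ uniform s∈W s∉ q∈ ⟩
        c s p  ≡⟨ D≡csp ⟨
        d p s  ∎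
      A≢B : d p q ≢ d q s
      A≢B A≡B = not-used s∈W s∉ (Valid.uses (valid-in p∈W (C⊆W p∈W q∈) p≢q) (self p) q∈ p≢q) (begin
        rec (C p) u p q  ≡⟨ d-in q∈ ⟨
        d p q            ≡⟨ A≡B ⟩
        d q s            ≡⟨ B≡D ⟩
        d p s            ≡⟨ D≡csp ⟩
        c s p            ∎)

    d-admissible : ∀ {x y z} → x ∈ W → y ∈ W → z ∈ W → x ≢ y → y ≢ z → x ≢ z →
      Admissible (d x y) (d y z) (d x z)
    d-admissible {x} {y} {z} x∈W y∈W z∈W x≢y y≢z x≢z = by-components (y ∈? C x) (z ∈? C x) (z ∈? C y)
      where
      by-components : Dec (y ∈ C x) → Dec (z ∈ C x) → Dec (z ∈ C y) → Admissible (d x y) (d y z) (d x z)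
      by-components (yes y∈) (yes z∈) _ =
        adm-≡ (d-within x∈W (self x) y∈) (d-within x∈W y∈ z∈) (d-within x∈W (self x) z∈)
          (Valid.admissible (valid-in x∈W y∈W x≢y) (self x) y∈ z∈ x≢y y≢z x≢z)
      by-components (yes y∈) (no z∉) _ = two-in-one x∈W y∈ x≢y z∈W z∉
      by-components (no y∉) (yes z∈) _ =
        adm-≡ refl (d-symmetric y∈W z∈W) refl (adm-swap₁₃ (two-in-one x∈W z∈ x≢z y∈W y∉))
      by-components (no y∉) (no z∉) (yes z∈Cy) = adm-≡ (d-symmetric x∈W y∈W) refl (d-symmetric x∈W z∈W)
        (adm-swap₂₃ (adm-swap₁₃ (two-in-one y∈W z∈Cy y≢z x∈W (C-outside-symm y∈W y∉))))
      by-components (no y∉) (no z∉) (no z∉Cy) = adm-≡ (d-out y∉) (d-out z∉Cy) (d-out z∉) (c-adm x≢y y≢z x≢z)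

    merge-valid : Valid d W u
    merge-valid = record
      { symmetric = d-symmetric
      ; admissible = d-admissible
      ; avoids = avoids
      ; uses = uses }
      where
      avoids : ∀ {x y} → x ∈ W → y ∈ W → x ≢ y → d x y ≢ u
      avoids {x} {y} x∈W y∈W x≢y = by-component (y ∈? C x)
        where
        by-component : Dec (y ∈ C x) → d x y ≢ u
        by-component (yes y∈) =
          subst (_≢ u) (sym (d-in y∈)) (Valid.avoids (valid-in x∈W y∈W x≢y) (self x) y∈ x≢y)
        by-component (no y∉) dxy≡u = y∉ (closed (self x) y∈W (trans (sym (d-out y∉)) dxy≡u))
      uses : ∀ {x y} → x ∈ W → y ∈ W → x ≢ y → Used W (d x y)
      uses {x} {y} x∈W y∈W x≢y = by-component (y ∈? C x)
        where
        by-component : Dec (y ∈ C x) → Used W (d x y)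
        by-component (yes y∈) = subst (Used W) (sym (d-in y∈))
          (Used-mono (C⊆W x∈W) (Valid.uses (valid-in x∈W y∈W x≢y) (self x) y∈ x≢y))
        by-component (no y∉) = inj₂ (x , y , x∈W , y∈W , x≢y , sym (d-out y∉))

  layer : (Subset N → Fin k → EdgeColoring k N) → (W : Subset N) → Fin k → Dec (Nonempty W) →
    EdgeColoring k N
  layer rec W t (no _) = c
  layer rec W t (yes (v , _)) x y = transpose t (cv v) (merge rec W (cv v) x y)

  recolour : ℕ → Subset N → Fin k → EdgeColoring k N
  recolour zero W t = c
  recolour (suc f) W t = layer (recolour f) W t (nonempty? W)

  layer-valid : ∀ rec W t (w? : Dec (Nonempty W)) → (∀ S t → ∣ S ∣ < ∣ W ∣ → Valid (rec S t) S t) →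
    Valid (layer rec W t w?) W t
  layer-valid rec W t (no empty) _ = valid-empty c W t λ x x∈ → empty (x , x∈)
  layer-valid rec W t (yes (v , v∈W)) rec-valid =
    valid-transpose t (cv v) (inj₁ (v , v∈W , refl)) (MergeValid.merge-valid rec W v∈W rec-valid)

  recolour-valid : ∀ f W t → ∣ W ∣ ≤ f → Valid (recolour f W t) W t
  recolour-valid zero W t W≤0 = valid-empty c W t λ x x∈ → contradiction (<-≤-trans (∣∣-pos x∈) W≤0) λ ()
  recolour-valid (suc f) W t W≤ = layer-valid (recolour f) W t (nonempty? W)
    λ S t′ S<W → recolour-valid f S t′ (≤-pred (<-≤-trans S<W W≤))

lower : ∀ {m} → Fin (suc (suc m)) → Fin (suc m)
lower zero = zero
lower (suc a) = a

lower-injective : ∀ {m} {a b : Fin (suc (suc m))} → a ≢ zero → b ≢ zero → lower a ≡ lower b → a ≡ b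
lower-injective {a = zero} a≢0 _ _ = contradiction refl a≢0
lower-injective {a = suc _} {zero} _ b≢0 _ = contradiction refl b≢0
lower-injective {a = suc _} {suc _} _ _ e = cong suc e

admissible-triangles : ∀ {k N} (c : EdgeColoring k N) → ¬ RainbowTriangle c → ¬ MonoK3 c →
  ∀ {x y z} → x ≢ y → y ≢ z → x ≢ z → Admissible (c x y) (c y z) (c x z)
admissible-triangles c no-rainbow no-mono {x} {y} {z} x≢y y≢z x≢z =
  decidable-stable (c x y ≟ c y z ⊎-dec c y z ≟ c x z ⊎-dec c x y ≟ c x z)
    (λ none → no-rainbow (x , y , z , x≢y , y≢z , x≢z ,
      none ∘ inj₁ , none ∘ inj₂ ∘ inj₁ , none ∘ inj₂ ∘ inj₂)) ,
  λ (p , q) → no-mono (x , y , z , x≢y , y≢z , x≢z , p , q)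

lowered : ∀ {m N} → EdgeColoring (suc (suc m)) N → EdgeColoring (suc m) N
lowered d x y = lower (d x y)

lowered-bad : ∀ {m N} (d : EdgeColoring (suc (suc m)) N) → SymmetricColoring d →
  (∀ {x y z} → x ≢ y → y ≢ z → x ≢ z → Admissible (d x y) (d y z) (d x z)) →
  (∀ {x y} → x ≢ y → d x y ≢ zero) → Gallai (lowered d) × ¬ MonoK3 (lowered d)
lowered-bad d sym-d adm avoids-0 = ((λ x y → cong lower (sym-d x y)) , no-rainbow) , no-mono
  where
  no-rainbow : ¬ RainbowTriangle (lowered d)
  no-rainbow (x , y , z , x≢y , y≢z , x≢z , p , q , r) = two-equal (proj₁ (adm x≢y y≢z x≢z))
    where
    two-equal : d x y ≡ d y z ⊎ d y z ≡ d x z ⊎ d x y ≡ d x z → ⊥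
    two-equal (inj₁ e) = p (cong lower e)
    two-equal (inj₂ (inj₁ e)) = q (cong lower e)
    two-equal (inj₂ (inj₂ e)) = r (cong lower e)
  no-mono : ¬ MonoK3 (lowered d)
  no-mono (x , y , z , x≢y , y≢z , x≢z , p , q) = proj₂ (adm x≢y y≢z x≢z)
    (lower-injective (avoids-0 x≢y) (avoids-0 y≢z) p , lower-injective (avoids-0 y≢z) (avoids-0 x≢z) q)

proper-from-ordered : ∀ {k N} (cv : Fin N → Fin k) (c : EdgeColoring k N) → SymmetricColoring c →
  ¬ (∃[ i ] ∃[ j ] (i <ᶠ j × (c i j ≡ cv i ⊎ c i j ≡ cv j))) → ∀ {x y} → x ≢ y → c x y ≢ cv x
proper-from-ordered cv c sym-c no-conflict {x} {y} x≢y e with FinP.<-cmp x y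
... | tri< x<y _ _ = no-conflict (x , y , x<y , inj₁ e)
... | tri≈ _ x≡y _ = x≢y x≡y
... | tri> _ _ y<x = no-conflict (y , x , y<x , inj₂ (trans (sym-c y x) e))

gr→star : ∀ m N → GRK3Prop (suc m) N → GRStarK3Prop (suc (suc m)) N
gr→star m N h cv c sym-c with rainbow? c
... | yes rainbow = inj₁ rainbow
... | no no-rainbow with monoK3? c
...   | yes mono = inj₂ (inj₁ (mono→hom c sym-c mono))
...   | no no-mono with FinP.any? (λ i → FinP.any? λ j → i FinP.<? j ×-dec (c i j ≟ cv i ⊎-dec c i j ≟ cv j))
...     | yes conflict = inj₂ (inj₂ conflict)
...     | no no-conflict = contradiction (h (lowered d) (proj₁ bad)) (proj₂ bad)
  where
  open Elimination cv c sym-c (admissible-triangles c no-rainbow no-mono)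
    (proper-from-ordered cv c sym-c no-conflict)
  d : EdgeColoring (suc (suc m)) N
  d = recolour N ⊤ zero
  open Valid (recolour-valid N ⊤ zero (∣p∣≤n ⊤))
  bad : Gallai (lowered d) × ¬ MonoK3 (lowered d)
  bad = lowered-bad d (λ x y → symmetric ∈⊤ ∈⊤) (admissible ∈⊤ ∈⊤ ∈⊤) (avoids ∈⊤ ∈⊤)

transfer : ∀ {P Q : ℕ → Set} {N} → (∀ n → P n → Q n) → (∀ n → Q n → P n) → IsMin Q N → IsMin P N
transfer P→Q Q→P (QN , minimal) = Q→P _ QN , λ n Pn → minimal n (P→Q n Pn)

lemma3p3 : ∀ (k : ℕ) → 2 ≤ k →
    ∃[ N ] (IsMin (GRStarK3Prop k) N × IsMin (GRHK3Prop (k ∸ 1)) N × IsMin (GRK3Prop (k ∸ 1)) N)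
lemma3p3 (suc zero) (s≤s ())
lemma3p3 (suc (suc m)) _ = conclude (least (grK3? (suc m)) (grK3-bounded (suc m)))
  where
  conclude : ∃[ N ] IsMin (GRK3Prop (suc m)) N →
    ∃[ N ] (IsMin (GRStarK3Prop (suc (suc m))) N × IsMin (GRHK3Prop (suc m)) N × IsMin (GRK3Prop (suc m)) N)
  conclude (N , minimal) =
    N , transfer (star→gr (suc m)) (gr→star m) minimal ,
        transfer (grH→gr (suc m)) (gr→grH (suc m)) minimal ,
        minimal
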